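{- Let $\mathbf{A},\mathbf{B},\mathbf{C}$ be categories, let $\kappa=(\mathrm{get}^\kappa,\mathrm{put}^\kappa)$ be an ala-lens from $\mathbf{A}$ to $\mathbf{B}$ with parameter category $\mathbf{P}$, and let $\ell=(\mathrm{get}^\ell,\mathrm{put}^\ell)$ be an ala-lens from $\mathbf{B}$ to $\mathbf{C}$ with parameter category $\mathbf{Q}$. Let $\kappa;\ell$ be their sequential composition (an ala-lens from $\mathbf{A}$ to $\mathbf{C}$ with parameter category $\mathbf{P}\times\mathbf{Q}$). If $\kappa$ and $\ell$ are both well-behaved, then $\kappa;\ell$ is well-behaved.
   Context: Notation: for a category $\mathbf{X}$, $|\mathbf{X}|$ is its class of objects; composition of arrows is written in diagrammatic order $u;u'$. Parameterized functor: given categories $\mathbf{S},\mathbf{T},\mathbf{P}$, a functor $\mathrm{get}:\mathbf{P}\to[\mathbf{S},\mathbf{T}]$ into the category of functors $\mathbf{S}\to\mathbf{T}$ and natural transformations. For $p\in|\mathbf{P}|$ write $\mathrm{get}_p=\mathrm{get}(p)$ and $S_p=\mathrm{get}_p(S)$; for $e:p\to p'$ in $\mathbf{P}$, $\mathrm{get}_e=\mathrm{get}(e):\mathrm{get}_p\Rightarrow\mathrm{get}_{p'}$, with component $e_S=\mathrm{get}_e(S):S_p\to S_{p'}$. For an arrow $u:S\to S'$ in $\mathbf{S}$ write $u.\mathrm{get}_e:=e_S;\mathrm{get}_{p'}(u)=\mathrm{get}_p(u);e_{S'}:S_p\to S'_{p'}$. Ala-lens (asymmetric learning delta lens with amendment)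 from $\mathbf{S}$ to $\mathbf{T}$ with parameter category $\mathbf{P}$: a pair $(\mathrm{get},\mathrm{put})$ where $\mathrm{get}:\mathbf{P}\to[\mathbf{S},\mathbf{T}]$ is a parameterized functor and $\mathrm{put}$ consists of three families of operations indexed by $(p,S)\in|\mathbf{P}|\times|\mathbf{S}|$: for every arrow $v:S_p\to T'$ in $\mathbf{T}$ they return $\mathrm{put}^{\mathrm{upd}}_{p,S}(v):p\to p'$ in $\mathbf{P}$, $\mathrm{put}^{\mathrm{req}}_{p,S}(v):S\to S'$ in $\mathbf{S}$, and $\mathrm{put}^{\mathrm{self}}_{p,S}(v)=:v^@:T'\to \mathrm{get}_{p'}(S')$ in $\mathbf{T}$ (the amendment), where $p'$ and $S'$ are the codomains of the first two arrows (so the codomain of $v;v^@$ equals $\mathrm{get}_{p'}$ applied to the codomain of $\mathrm{put}^{\mathrm{req}}_{p,S}(v)$). Well-behaved ala-lens: for all $p\in|\mathbf{P}|$, $S\in|\mathbf{S}|$, $v:S_p\to T'$: (Stability) $\mathrm{put}^{\mathrm{upd}}_{p,S}(\mathrm{id}_{S_p})=\mathrm{id}_p$, $\mathrm{put}^{\mathrm{req}}_{p,S}(\mathrm{id}_{S_p})=\mathrm{id}_S$, $\mathrm{put}^{\mathrm{self}}_{p,S}(\mathrm{id}_{S_p})=\mathrm{id}_{S_p}$; (Putget) $(\mathrm{put}^{\mathrm{req}}_{p,S}(v)).\mathrm{get}_e=v;v^@$ where $e=\mathrm{put}^{\mathrm{upd}}_{p,S}(v)$ and $v^@=\mathrm{put}^{\mathrm{self}}_{p,S}(v)$.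 Sequential composition $\kappa;\ell$: parameter category $\mathbf{P}\times\mathbf{Q}$; $\mathrm{get}^{\kappa;\ell}_{(p,q)}=\mathrm{get}^\kappa_p;\mathrm{get}^\ell_q$ (first $\mathrm{get}^\kappa_p$, then $\mathrm{get}^\ell_q$), and for $(e,h):(p,q)\to(p',q')$, $\mathrm{get}^{\kappa;\ell}_{(e,h)}$ is the horizontal (Godement) composite of $\mathrm{get}^\kappa_e$ and $\mathrm{get}^\ell_h$. For $A\in|\mathbf{A}|$, $(p,q)$, and $w:\mathrm{get}^\ell_q(\mathrm{get}^\kappa_p(A))\to C'$ in $\mathbf{C}$, put $B=\mathrm{get}^\kappa_p(A)$, $h=\mathrm{put}^{\ell,\mathrm{upd}}_{q,B}(w):q\to q'$, $v=\mathrm{put}^{\ell,\mathrm{req}}_{q,B}(w):B\to B'$, $w^@=\mathrm{put}^{\ell,\mathrm{self}}_{q,B}(w)$, then $e=\mathrm{put}^{\kappa,\mathrm{upd}}_{p,A}(v):p\to p'$, $u=\mathrm{put}^{\kappa,\mathrm{req}}_{p,A}(v)$, $v^@=\mathrm{put}^{\kappa,\mathrm{self}}_{p,A}(v)$; and define $\mathrm{put}^{\kappa;\ell,\mathrm{upd}}_{(p,q),A}(w)=(e,h)$, $\mathrm{put}^{\kappa;\ell,\mathrm{req}}_{(p,q),A}(w)=u$, $\mathrm{put}^{\kappa;\ell,\mathrm{self}}_{(p,q),A}(w)=w^@;\mathrm{get}^\ell_{q'}(v^@)$. -}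

module Defs where

open import Level using (Level; _⊔_) renaming (suc to lsuc)
open import Data.Product using (_×_; _,_; proj₁; proj₂)
open import Relation.Binary.PropositionalEquality
  using (_≡_; refl; sym; trans; cong; cong₂; module ≡-Reasoning)

-- Categories (composition in diagrammatic order: f ⨾ g = "f then g").
-- Equality of arrows is propositional equality.

record Category (o h : Level) : Set (lsuc (o ⊔ h)) where
  infixr 9 _⨾_
  field
    Obj   : Set o
    Hom   : Obj → Obj → Set h
    id    : (X : Obj) → Hom X X
    _⨾_   : {X Y Z : Obj} → Hom X Y → Hom Y Z → Hom X Z
    idˡ   : {X Y : Obj} (f : Hom X Y) → id X ⨾ f ≡ f
    idʳ   : {X Y : Obj} (f : Hom X Y) → f ⨾ id Y ≡ f
    assoc : {W X Y Z : Obj} (f : Hom W X) (g : Hom X Y) (k : Hom Y Z) →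
            (f ⨾ g) ⨾ k ≡ f ⨾ (g ⨾ k)

open Category public using (Obj; Hom)

private
  variable
    o₁ h₁ o₂ h₂ o₃ h₃ o₄ h₄ o₅ h₅ : Level

_×ᶜ_ : Category o₁ h₁ → Category o₂ h₂ → Category (o₁ ⊔ o₂) (h₁ ⊔ h₂)
P ×ᶜ Q = record
  { Obj   = Obj P × Obj Q
  ; Hom   = λ x y → Hom P (proj₁ x) (proj₁ y) × Hom Q (proj₂ x) (proj₂ y)
  ; id    = λ x → (P.id (proj₁ x) , Q.id (proj₂ x))
  ; _⨾_   = λ f g → (proj₁ f P.⨾ proj₁ g , proj₂ f Q.⨾ proj₂ g)
  ; idˡ   = λ f → cong₂ _,_ (P.idˡ (proj₁ f)) (Q.idˡ (proj₂ f))
  ; idʳ   = λ f → cong₂ _,_ (P.idʳ (proj₁ f)) (Q.idʳ (proj₂ f))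
  ; assoc = λ f g k → cong₂ _,_ (P.assoc (proj₁ f) (proj₁ g) (proj₁ k))
                                (Q.assoc (proj₂ f) (proj₂ g) (proj₂ k))
  }
  where
    module P = Category P
    module Q = Category Q

record Functor (S : Category o₁ h₁) (T : Category o₂ h₂)
       : Set (o₁ ⊔ h₁ ⊔ o₂ ⊔ h₂) where
  private
    module S = Category S
    module T = Category T
  field
    F₀    : Obj S → Obj T
    F₁    : {X Y : Obj S} → Hom S X Y → Hom T (F₀ X) (F₀ Y)
    F-id  : (X : Obj S) → F₁ (S.id X) ≡ T.id (F₀ X)
    F-⨾   : {X Y Z : Obj S} (f : Hom S X Y) (g : Hom S Y Z) →
            F₁ (f S.⨾ g) ≡ F₁ f T.⨾ F₁ g

open Functor public

record NatTrans {S : Category o₁ h₁} {T : Category o₂ h₂}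
                (F G : Functor S T) : Set (o₁ ⊔ h₁ ⊔ h₂) where
  private
    module S = Category S
    module T = Category T
  field
    η   : (X : Obj S) → Hom T (F₀ F X) (F₀ G X)
    nat : {X Y : Obj S} (f : Hom S X Y) →
          F₁ F f T.⨾ η Y ≡ η X T.⨾ F₁ G f

open NatTrans public

_⨾F_ : {S : Category o₁ h₁} {T : Category o₂ h₂} {U : Category o₃ h₃} →
       Functor S T → Functor T U → Functor S U
_⨾F_ {S = S} {T} {U} F G = record
  { F₀   = λ X → F₀ G (F₀ F X)
  ; F₁   = λ f → F₁ G (F₁ F f)
  ; F-id = λ X → trans (cong (F₁ G) (F-id F X)) (F-id G (F₀ F X))
  ; F-⨾  = λ f g → trans (cong (F₁ G) (F-⨾ F f g)) (F-⨾ G (F₁ F f) (F₁ F g))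
  }

-- Horizontal (Godement) composite of α : F ⇒ F' and β : G ⇒ G',
-- a natural transformation F⨾G ⇒ F'⨾G'; component at X is
-- β_{F X} ⨾ G'(α_X)  (= G(α_X) ⨾ β_{F' X} by naturality).
horiz : {S : Category o₁ h₁} {T : Category o₂ h₂} {U : Category o₃ h₃}
        {F F' : Functor S T} {G G' : Functor T U} →
        NatTrans F F' → NatTrans G G' → NatTrans (F ⨾F G) (F' ⨾F G')
horiz {S = S} {T} {U} {F} {F'} {G} {G'} α β = record
  { η   = λ X → η β (F₀ F X) U.⨾ F₁ G' (η α X)
  ; nat = λ {X} {Y} f →
      let open ≡-Reasoning in
      begin
        F₁ G (F₁ F f) U.⨾ (η β (F₀ F Y) U.⨾ F₁ G' (η α Y))
          ≡⟨ sym (U.assoc _ _ _) ⟩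
        (F₁ G (F₁ F f) U.⨾ η β (F₀ F Y)) U.⨾ F₁ G' (η α Y)
          ≡⟨ cong (U._⨾ F₁ G' (η α Y)) (nat β (F₁ F f)) ⟩
        (η β (F₀ F X) U.⨾ F₁ G' (F₁ F f)) U.⨾ F₁ G' (η α Y)
          ≡⟨ U.assoc _ _ _ ⟩
        η β (F₀ F X) U.⨾ (F₁ G' (F₁ F f) U.⨾ F₁ G' (η α Y))
          ≡⟨ cong (η β (F₀ F X) U.⨾_) (sym (F-⨾ G' _ _)) ⟩
        η β (F₀ F X) U.⨾ F₁ G' (F₁ F f T.⨾ η α Y)
          ≡⟨ cong (λ z → η β (F₀ F X) U.⨾ F₁ G' z) (nat α f) ⟩
        η β (F₀ F X) U.⨾ F₁ G' (η α X T.⨾ F₁ F' f)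
          ≡⟨ cong (η β (F₀ F X) U.⨾_) (F-⨾ G' _ _) ⟩
        η β (F₀ F X) U.⨾ (F₁ G' (η α X) U.⨾ F₁ G' (F₁ F' f))
          ≡⟨ sym (U.assoc _ _ _) ⟩
        (η β (F₀ F X) U.⨾ F₁ G' (η α X)) U.⨾ F₁ G' (F₁ F' f)
      ∎
  }
  where
    module T = Category T
    module U = Category U

-- Parameterized functor get : P → [S , T], written out: a functor
-- get_p for every object p, a natural transformation get_e for every
-- arrow e, and functoriality of p ↦ get_p (componentwise equality of
-- natural transformations, which is equality in [S , T]).

record ParamFunctor (P : Category o₁ h₁) (S : Category o₂ h₂)
                    (T : Category o₃ h₃)
       : Set (o₁ ⊔ h₁ ⊔ o₂ ⊔ h₂ ⊔ o₃ ⊔ h₃) where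
  private
    module P = Category P
    module T = Category T
  field
    getO    : Obj P → Functor S T
    getA    : {p p' : Obj P} → Hom P p p' → NatTrans (getO p) (getO p')
    get-id  : (p : Obj P) (X : Obj S) →
              η (getA (P.id p)) X ≡ T.id (F₀ (getO p) X)
    get-⨾   : {p p' p'' : Obj P} (e : Hom P p p') (e' : Hom P p' p'')
              (X : Obj S) →
              η (getA (e P.⨾ e')) X ≡ η (getA e) X T.⨾ η (getA e') X

open ParamFunctor public

dotGet : {P : Category o₁ h₁} {S : Category o₂ h₂} {T : Category o₃ h₃}
         (G : ParamFunctor P S T) {p p' : Obj P} {X X' : Obj S} →
         Hom S X X' → Hom P p p' →
         Hom T (F₀ (getO G p) X) (F₀ (getO G p') X')
dotGet {T = T} G {p' = p'} {X} u e =
  Category._⨾_ T (η (getA G e) X) (F₁ (getO G p') u)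

record PutResult {P : Category o₁ h₁} {S : Category o₂ h₂}
                 {T : Category o₃ h₃} (G : ParamFunctor P S T)
                 (p : Obj P) (X : Obj S) (T' : Obj T)
       : Set (o₁ ⊔ h₁ ⊔ o₂ ⊔ h₂ ⊔ h₃) where
  constructor putResult
  field
    p'   : Obj P
    upd  : Hom P p p'
    S'   : Obj S
    req  : Hom S X S'
    self : Hom T T' (F₀ (getO G p') S')

open PutResult public

record AlaLens (S : Category o₂ h₂) (T : Category o₃ h₃)
               (P : Category o₁ h₁)
       : Set (o₁ ⊔ h₁ ⊔ o₂ ⊔ h₂ ⊔ o₃ ⊔ h₃) where
  field
    get : ParamFunctor P S T
    put : (p : Obj P) (X : Obj S) {T' : Obj T} →
          Hom T (F₀ (getO get p) X) T' → PutResult get p X T'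

open AlaLens public

record WellBehaved {S : Category o₂ h₂} {T : Category o₃ h₃}
                   {P : Category o₁ h₁} (L : AlaLens S T P)
       : Set (o₁ ⊔ h₁ ⊔ o₂ ⊔ h₂ ⊔ o₃ ⊔ h₃) where
  private
    module P = Category P
    module S = Category S
    module T = Category T
  field
    -- Stability: put^upd(id) = id_p, put^req(id) = id_S, put^self(id) = id
    -- (stated jointly, since the types of req/self depend on upd/req)
    stability : (p : Obj P) (X : Obj S) →
      put L p X (T.id (F₀ (getO (get L) p) X))
        ≡ putResult p (P.id p) X (S.id X) (T.id (F₀ (getO (get L) p) X))
    putget : (p : Obj P) (X : Obj S) {T' : Obj T}
             (v : Hom T (F₀ (getO (get L) p) X) T') →
      dotGet (get L) (req (put L p X v)) (upd (put L p X v))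
        ≡ v T.⨾ self (put L p X v)

composeGet : {A : Category o₁ h₁} {B : Category o₂ h₂} {C : Category o₃ h₃}
             {P : Category o₄ h₄} {Q : Category o₅ h₅} →
             ParamFunctor P A B → ParamFunctor Q B C →
             ParamFunctor (P ×ᶜ Q) A C
composeGet {A = A} {B} {C} {P} {Q} K L = record
  { getO   = λ pq → getO K (proj₁ pq) ⨾F getO L (proj₂ pq)
  ; getA   = λ eh → horiz (getA K (proj₁ eh)) (getA L (proj₂ eh))
  ; get-id = λ pq X →
      let open ≡-Reasoning
          p = proj₁ pq ; q = proj₂ pq
          Gq = getO L q ; Fp = getO K p in
      begin
        η (getA L (Q.id q)) (F₀ Fp X) C.⨾ F₁ Gq (η (getA K (P.id p)) X)
          ≡⟨ cong₂ C._⨾_ (get-id L q (F₀ Fp X))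
                         (trans (cong (F₁ Gq) (get-id K p X)) (F-id Gq _)) ⟩
        C.id _ C.⨾ C.id _
          ≡⟨ C.idˡ _ ⟩
        C.id _
      ∎
  ; get-⨾  = λ {pq} {pq'} {pq''} eh eh' X →
      let open ≡-Reasoning
          e = proj₁ eh ; h = proj₂ eh ; e' = proj₁ eh' ; h' = proj₂ eh'
          F = getO K (proj₁ pq) ; F' = getO K (proj₁ pq')
          G' = getO L (proj₂ pq') ; G'' = getO L (proj₂ pq'')
          a = η (getA L h) (F₀ F X) ; b = η (getA L h') (F₀ F X)
          c = F₁ G'' (η (getA K e) X) ; d = F₁ G'' (η (getA K e') X) in
      begin
        η (getA L (h Q.⨾ h')) (F₀ F X) C.⨾ F₁ G'' (η (getA K (e P.⨾ e')) X)
          ≡⟨ cong₂ C._⨾_ (get-⨾ L h h' (F₀ F X))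
                         (trans (cong (F₁ G'') (get-⨾ K e e' X)) (F-⨾ G'' _ _)) ⟩
        (a C.⨾ b) C.⨾ (c C.⨾ d)
          ≡⟨ C.assoc _ _ _ ⟩
        a C.⨾ (b C.⨾ (c C.⨾ d))
          ≡⟨ cong (a C.⨾_) (sym (C.assoc _ _ _)) ⟩
        a C.⨾ ((b C.⨾ c) C.⨾ d)
          ≡⟨ cong (λ z → a C.⨾ (z C.⨾ d)) (sym (nat (getA L h') (η (getA K e) X))) ⟩
        a C.⨾ ((F₁ G' (η (getA K e) X) C.⨾ η (getA L h') (F₀ F' X)) C.⨾ d)
          ≡⟨ cong (a C.⨾_) (C.assoc _ _ _) ⟩
        a C.⨾ (F₁ G' (η (getA K e) X) C.⨾ (η (getA L h') (F₀ F' X) C.⨾ d))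
          ≡⟨ sym (C.assoc _ _ _) ⟩
        (a C.⨾ F₁ G' (η (getA K e) X)) C.⨾ (η (getA L h') (F₀ F' X) C.⨾ d)
      ∎
  }
  where
    module P = Category P
    module Q = Category Q
    module C = Category C

_⨾L_ : {A : Category o₁ h₁} {B : Category o₂ h₂} {C : Category o₃ h₃}
       {P : Category o₄ h₄} {Q : Category o₅ h₅} →
       AlaLens A B P → AlaLens B C Q → AlaLens A C (P ×ᶜ Q)
_⨾L_ {C = C} κ ℓ = record
  { get = composeGet (get κ) (get ℓ)
  ; put = λ pq X w →
      let B  = F₀ (getO (get κ) (proj₁ pq)) X
          rℓ = put ℓ (proj₂ pq) B w
          rκ = put κ (proj₁ pq) X (req rℓ)
      in putResult (p' rκ , p' rℓ) (upd rκ , upd rℓ) (S' rκ) (req rκ)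
                   (Category._⨾_ C (self rℓ) (F₁ (getO (get ℓ) (p' rℓ)) (self rκ)))
  }

module Submission where

open import Level using (Level)
open import Defs
open import Data.Product using (_,_)
open import Relation.Binary.PropositionalEquality
  using (_≡_; cong; trans; sym; module ≡-Reasoning)

-- The composite's u.get_{(e,h)} is (u.get_e).get_h, and u.get_e is functorial
-- in u; so putget of κ, transported along get^ℓ, turns into putget of ℓ
-- followed by get^ℓ of κ's amendment, which is the composite amendment.
-- Stability: both lenses send identities to identities and get^ℓ preserves them.

private
  variable
    oA hA oB hB oC hC oP hP oQ hQ : Level

module _ {P : Category oP hP} {S : Category oA hA} {T : Category oB hB}
         (G : ParamFunctor P S T) where
  private
    module S = Category S
    module T = Category T

  dotGet-⨾ : {p p' : Obj P} {X Y Z : Obj S}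
             (u : Hom S X Y) (u' : Hom S Y Z) (e : Hom P p p') →
             dotGet G (u S.⨾ u') e ≡ dotGet G u e T.⨾ F₁ (getO G p') u'
  dotGet-⨾ {p' = p'} {X} u u' e = begin
    η (getA G e) X T.⨾ F₁ (getO G p') (u S.⨾ u')
      ≡⟨ cong (η (getA G e) X T.⨾_) (F-⨾ (getO G p') u u') ⟩
    η (getA G e) X T.⨾ (F₁ (getO G p') u T.⨾ F₁ (getO G p') u')
      ≡⟨ sym (T.assoc _ _ _) ⟩
    dotGet G u e T.⨾ F₁ (getO G p') u'
      ∎
    where open ≡-Reasoning

module _ {A : Category oA hA} {B : Category oB hB} {C : Category oC hC}
         {P : Category oP hP} {Q : Category oQ hQ}
         (K : ParamFunctor P A B) (L : ParamFunctor Q B C) where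

  dotGet-composeGet : {p p' : Obj P} {q q' : Obj Q} {X X' : Obj A}
                      (u : Hom A X X') (e : Hom P p p') (h : Hom Q q q') →
                      dotGet (composeGet K L) u (e , h)
                        ≡ dotGet L (dotGet K u e) h
  dotGet-composeGet {p' = p'} {X = X} u e h =
    sym (dotGet-⨾ L (η (getA K e) X) (F₁ (getO K p') u) h)

module _ {A : Category oA hA} {B : Category oB hB} {C : Category oC hC}
         {P : Category oP hP} {Q : Category oQ hQ}
         (κ : AlaLens A B P) (ℓ : AlaLens B C Q)
         (wκ : WellBehaved κ) (wℓ : WellBehaved ℓ) where
  private
    module A = Category A
    module C = Category C
    module P = Category P
    module Q = Category Q
    open WellBehaved

  stability-⨾L : (p : Obj P) (q : Obj Q) (X : Obj A) →
    let idᶜ = C.id (F₀ (getO (get ℓ) q) (F₀ (getO (get κ) p) X)) in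
    put (κ ⨾L ℓ) (p , q) X idᶜ ≡ putResult (p , q) (P.id p , Q.id q) X (A.id X) idᶜ
  stability-⨾L p q X
    rewrite stability wℓ q (F₀ (getO (get κ) p) X) | stability wκ p X
    = cong (putResult (p , q) (P.id p , Q.id q) X (A.id X))
           (trans (C.idˡ _) (F-id (getO (get ℓ) q) _))

  putget-⨾L : (p : Obj P) (q : Obj Q) (X : Obj A) {C' : Obj C}
              (w : Hom C (F₀ (getO (get ℓ) q) (F₀ (getO (get κ) p) X)) C') →
    let r = put (κ ⨾L ℓ) (p , q) X w in
    dotGet (get (κ ⨾L ℓ)) (req r) (upd r) ≡ w C.⨾ self r
  putget-⨾L p q X w = begin
    dotGet (get (κ ⨾L ℓ)) (req rκ) (upd rκ , upd rℓ)
      ≡⟨ dotGet-composeGet (get κ) (get ℓ) (req rκ) (upd rκ) (upd rℓ) ⟩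
    dotGet (get ℓ) (dotGet (get κ) (req rκ) (upd rκ)) (upd rℓ)
      ≡⟨ cong (λ v → dotGet (get ℓ) v (upd rℓ)) (putget wκ p X (req rℓ)) ⟩
    dotGet (get ℓ) (req rℓ B.⨾ self rκ) (upd rℓ)
      ≡⟨ dotGet-⨾ (get ℓ) (req rℓ) (self rκ) (upd rℓ) ⟩
    dotGet (get ℓ) (req rℓ) (upd rℓ) C.⨾ F₁ Gℓ (self rκ)
      ≡⟨ cong (C._⨾ F₁ Gℓ (self rκ)) (putget wℓ q (F₀ (getO (get κ) p) X) w) ⟩
    (w C.⨾ self rℓ) C.⨾ F₁ Gℓ (self rκ)
      ≡⟨ C.assoc _ _ _ ⟩
    w C.⨾ (self rℓ C.⨾ F₁ Gℓ (self rκ))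
      ∎
    where
      open ≡-Reasoning
      module B = Category B
      rℓ = put ℓ q (F₀ (getO (get κ) p) X) w
      rκ = put κ p X (req rℓ)
      Gℓ = getO (get ℓ) (p' rℓ)

theorem1 : {oA hA oB hB oC hC oP hP oQ hQ : Level}
    {A : Category oA hA} {B : Category oB hB} {C : Category oC hC}
    {P : Category oP hP} {Q : Category oQ hQ}
    (κ : AlaLens A B P) (ℓ : AlaLens B C Q) →
    WellBehaved κ → WellBehaved ℓ → WellBehaved (κ ⨾L ℓ)
theorem1 κ ℓ wκ wℓ = record
  { stability = λ { (p , q) → stability-⨾L κ ℓ wκ wℓ p q }
  ; putget    = λ { (p , q) → putget-⨾L κ ℓ wκ wℓ p q }
  }
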